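{- Let $\mathcal S$ be a Büchi automaton over $\Sigma$, let $a\in\mathit{Ag}$, $e\in\mathit{AP}\setminus\mathit{AP}_a$, and $D\in\mathbb N$. The following are equivalent: (1) $\mathcal S$ is $D$-P-diagnosable wrt. $a$ and $e$, i.e., $\mathcal S\models\mathsf G(e\to\mathsf X^D\mathsf K_a\mathsf Pe)$; (2) there exists a $D$-P-diagnoser for $\mathcal S$ wrt. $a$ and $e$.
   Context: Fix a finite set $\mathit{AP}$ of atomic propositions, $\Sigma=2^{\mathit{AP}}$, and a finite set $\mathit{Ag}$ of agents with observable propositions $\mathit{AP}_a\subseteq\mathit{AP}$ and $\Sigma_a=2^{\mathit{AP}_a}$. $\mathit{obs}_a(\sigma)=\sigma\cap\mathit{AP}_a$, extended letterwise to words; $w_{\le k}$ is the length-$k$ prefix of $w$. A Büchi automaton $\mathcal S$ over $\Sigma$ accepts $L(\mathcal S)\subseteq\Sigma^\omega$ (infinite words with a run from the initial state visiting accepting states infinitely often). $\mathit{Pref}^+(L(\mathcal S))$ is the set of nonempty finite prefixes of words of $L(\mathcal S)$. Semantics for $w=\sigma_1\sigma_2\cdots\in L(\mathcal S)$, $k\ge1$: $e$ holds at $k$ iff $e\in\sigma_k$; $\mathsf X^D\varphi$ holds at $k$ iff $\varphi$ holds at $k+D$; $\mathsf P\varphi$ holds at $k$ iff $\varphi$ holds at some $1\le j\le k$; $\mathsf G\varphi$ holds at $k$ iff $\varphi$ holds at all $j\ge k$; $\mathsf K_a\varphi$ holds at $k$ iff $\varphi$ holds at $k$ in every $w'\in L(\mathcal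 S)$ with $\mathit{obs}_a(w_{\le k})=\mathit{obs}_a(w'_{\le k})$. $\mathcal S\models\varphi$ means $\varphi$ holds at position 1 of every $w\in L(\mathcal S)$. A finite word $\sigma_1\cdots\sigma_n$ is faulty if $e\in\sigma_i$ for some $i$, fault-free otherwise. A $D$-P-diagnoser for $\mathcal S$ (wrt. $a,e$) is a function $f\colon\Sigma_a^*\to\{0,1\}$ such that (Detection) for all faulty $u\in\Sigma^+$ and all $v\in\Sigma^*$ with $|v|=D$ and $uv\in\mathit{Pref}^+(L(\mathcal S))$, $f(\mathit{obs}_a(uv))=1$; and (No false alarms) for all fault-free $u\in\mathit{Pref}^+(L(\mathcal S))$, $f(\mathit{obs}_a(u))=0$. -}

module Defs where

open import Data.Nat using (ℕ; zero; suc; _+_; _≤_)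
open import Data.Fin using (Fin)
open import Data.Fin.Subset using (Subset; _∈_)
open import Data.Vec using (tabulate; lookup)
open import Data.Bool using (Bool; true; false)
open import Data.List using (List; []; _++_; map; length; applyUpTo)
open import Data.List.Relation.Unary.Any using (Any)
open import Data.Product using (Σ; ∃; _×_; _,_)
open import Relation.Binary.PropositionalEquality using (_≡_; _≢_)
open import Relation.Nullary using (¬_)
open import Function.Definitions using (Injective)

-- A setting: AP = Fin n, Ag = Fin nAg; the observable propositions AP_a of
-- agent a are given by an injective embedding ι a : Fin (obsSize a) → Fin n,
-- so that Σ_a = 2^{AP_a} is Subset (obsSize a).
record Setting : Set where
  field
    n       : ℕ
    nAg     : ℕ
    obsSize : Fin nAg → ℕ
    ι       : (a : Fin nAg) → Fin (obsSize a) → Fin n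
    ι-inj   : (a : Fin nAg) → Injective _≡_ _≡_ (ι a)

module _ (St : Setting) where
  open Setting St

  Letter : Set
  Letter = Subset n

  ObsLetter : Fin nAg → Set
  ObsLetter a = Subset (obsSize a)

  -- obs_a(σ) = σ ∩ AP_a, seen as an element of 2^{AP_a}
  obs : (a : Fin nAg) → Letter → ObsLetter a
  obs a σ = tabulate (λ j → lookup σ (ι a j))

  -- infinite words; index i (0-based) holds the letter σ_{i+1}
  Word : Set
  Word = ℕ → Letter

  prefix : Word → ℕ → List Letter
  prefix w k = applyUpTo w k

  record Buchi : Set where
    field
      nQ   : ℕ
      init : Fin nQ
      δ    : Fin nQ → Letter → Fin nQ → Bool
      acc  : Fin nQ → Bool

  Accepts : Buchi → Word → Set
  Accepts S w = Σ (ℕ → Fin nQ) λ r →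
      (r 0 ≡ init)
    × (∀ i → δ (r i) (w i) (r (suc i)) ≡ true)
    × (∀ N → ∃ λ k → N ≤ k × acc (r k) ≡ true)
    where open Buchi S

  Pref⁺ : Buchi → List Letter → Set
  Pref⁺ S u = (1 ≤ length u) × Σ Word (λ w → Accepts S w × prefix w (length u) ≡ u)

  data Formula : Set where
    atom : Fin n → Formula
    _⇒_  : Formula → Formula → Formula
    X    : ℕ → Formula → Formula
    P    : Formula → Formula
    G    : Formula → Formula
    K    : Fin nAg → Formula → Formula

  -- semantics; position i (0-based) is the paper's position i+1
  Holds : Buchi → Word → ℕ → Formula → Set
  Holds S w i (atom p) = p ∈ w i
  Holds S w i (φ ⇒ ψ)  = Holds S w i φ → Holds S w i ψ
  Holds S w i (X D φ)  = Holds S w (i + D) φ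
  Holds S w i (P φ)    = ∃ λ j → j ≤ i × Holds S w j φ
  Holds S w i (G φ)    = ∀ j → i ≤ j → Holds S w j φ
  Holds S w i (K a φ)  = ∀ w' → Accepts S w' →
      map (obs a) (prefix w (suc i)) ≡ map (obs a) (prefix w' (suc i)) →
      Holds S w' i φ

  Models : Buchi → Formula → Set
  Models S φ = ∀ w → Accepts S w → Holds S w 0 φ

  Faulty : Fin n → List Letter → Set
  Faulty e u = Any (e ∈_) u

  IsDiagnoser : Buchi → (a : Fin nAg) → Fin n → ℕ → (List (ObsLetter a) → Bool) → Set
  IsDiagnoser S a e D f =
      (∀ (u v : List Letter) → u ≢ [] → Faulty e u → length v ≡ D →
         Pref⁺ S (u ++ v) → f (map (obs a) (u ++ v)) ≡ true)
    × (∀ (u : List Letter) → Pref⁺ S u → ¬ Faulty e u → f (map (obs a) u) ≡ false)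

  diagFormula : Fin nAg → Fin n → ℕ → Formula
  diagFormula a e D = G (atom e ⇒ X D (K a (P (atom e))))

-- The diagnoser outputs 1 on an observation o iff some prefix of L(S) observed
-- as o is faulty at least D letters before its end. Under G(e → XᴰKₐPe) this
-- raises no false alarm: D steps after the fault of that prefix, a knows that a
-- fault has occurred, and a cannot distinguish it from the observed prefix.
-- Conversely, a failure of the formula yields two prefixes with equal
-- observations, one faulty D letters before its end and one fault-free, on which
-- every diagnoser would have to output both 1 and 0.
-- The diagnoser has to be computable, which rests on the decidability of
-- Pref⁺(L(S)): a state has an accepting run iff it reaches an accepting state
-- lying on a cycle, and reachability only needs paths without repeated states.
module Submission where

open import Defs
open import Data.Bool using (Bool; true; false; _≟_)
open import Data.Empty using (⊥-elim)
open import Data.Fin as Fin using (Fin; toℕ; fromℕ<)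
open import Data.Fin.Properties using (any?; pigeonhole; toℕ-fromℕ<) renaming (<⇒≢ to <⇒≢ᶠ)
open import Data.Fin.Subset using (_∈_)
open import Data.Fin.Subset.Properties using (anySubset?) renaming (_∈?_ to _∈ₛ?_)
open import Data.List using (List; []; _∷_; _++_; map; take; length; applyUpTo)
open import Data.List.Properties using (length-applyUpTo; length-map; length-++; take-map)
import Data.List.Properties as List
open import Data.List.Relation.Unary.Any using (Any)
import Data.List.Relation.Unary.Any as Any
open import Data.List.Relation.Unary.Any.Properties using (applyUpTo⁺; applyUpTo⁻)
open import Data.Nat using (ℕ; zero; suc; _+_; _*_; _∸_; _≤_; _<_; z≤n; s≤s; _≤?_)
open import Data.Nat.Properties hiding (_≟_)
open import Data.Product using (Σ; ∃; ∃₂; _×_; _,_; proj₁; proj₂)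
open import Data.Sum using (inj₁; inj₂)
open import Data.Vec using (Vec; []; _∷_; lookup)
import Data.Vec.Properties as Vec
open import Data.Vec.Relation.Unary.All using (All; []; _∷_)
open import Data.Vec.Relation.Unary.AllPairs using ([]; _∷_)
open import Data.Vec.Relation.Unary.Any using (here; there)
open import Data.Vec.Membership.Propositional using () renaming (_∈_ to _∈ᵥ_)
open import Data.Vec.Relation.Unary.Unique.Propositional using (Unique)
open import Data.Vec.Relation.Unary.Unique.Propositional.Properties using (lookup-injective)
open import Function using (_∘_)
open import Function.Bundles using (_⇔_; mk⇔)
open import Relation.Nullary using (¬_; Dec; yes; no; does; contradiction)
open import Relation.Nullary.Decidable using (_×-dec_; map′)
open import Relation.Binary.PropositionalEquality

module _ {A : Set} where

  _∷ω_ : A → (ℕ → A) → ℕ → A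
  (a ∷ω w) zero    = a
  (a ∷ω w) (suc i) = w i

  _++ω_ : List A → (ℕ → A) → ℕ → A
  []      ++ω w = w
  (a ∷ x) ++ω w = a ∷ω (x ++ω w)

  applyUpTo-++ω : ∀ x (w : ℕ → A) → applyUpTo (x ++ω w) (length x) ≡ x
  applyUpTo-++ω []      w = refl
  applyUpTo-++ω (a ∷ x) w = cong (a ∷_) (applyUpTo-++ω x w)

  applyUpTo-+ : ∀ (w : ℕ → A) m k →
                applyUpTo w (m + k) ≡ applyUpTo w m ++ applyUpTo (λ i → w (m + i)) k
  applyUpTo-+ w zero    k = refl
  applyUpTo-+ w (suc m) k = cong (w 0 ∷_) (applyUpTo-+ (w ∘ suc) m k)

  take-applyUpTo : ∀ (w : ℕ → A) {k m} → k ≤ m → take k (applyUpTo w m) ≡ applyUpTo w k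
  take-applyUpTo w z≤n       = refl
  take-applyUpTo w (s≤s k≤m) = cong (w 0 ∷_) (take-applyUpTo (w ∘ suc) k≤m)

  take-length-++ : ∀ (u v : List A) → take (length u) (u ++ v) ≡ u
  take-length-++ []      v = refl
  take-length-++ (a ∷ u) v = cong (a ∷_) (take-length-++ u v)

  ∃-ofLength? : (∀ {P : A → Set} → (∀ a → Dec (P a)) → Dec (∃ P)) →
                ∀ {Q : List A → Set} → (∀ x → Dec (Q x)) →
                ∀ m → Dec (∃ λ x → length x ≡ m × Q x)
  ∃-ofLength? ∃? Q? zero with Q? []
  ... | yes q = yes ([] , refl , q)
  ... | no ¬q = no λ { ([] , _ , q) → ¬q q }
  ∃-ofLength? ∃? Q? (suc m) with ∃? (λ a → ∃-ofLength? ∃? (Q? ∘ (a ∷_)) m)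
  ... | yes (a , x , refl , q) = yes (a ∷ x , refl , q)
  ... | no ∄ = no λ { (a ∷ x , refl , q) → ∄ (a , x , refl , q) }

  ∉⇒All≢ : ∀ {n x} {xs : Vec A n} → ¬ x ∈ᵥ xs → All (x ≢_) xs
  ∉⇒All≢ {xs = []}     _  = []
  ∉⇒All≢ {xs = y ∷ ys} x∉ = (x∉ ∘ here) ∷ ∉⇒All≢ (x∉ ∘ there)

<∸⇒+< : ∀ {j m n} → j < m ∸ n → j + n < m
<∸⇒+< {j} {m} {n} j<m∸n = m≤o∸n⇒m+n≤o (suc j) n≤m j<m∸n
  where
  n≤m : n ≤ m
  n≤m = <⇒≤ (m∸n≢0⇒n<m λ m∸n≡0 → n≮0 (subst (j <_) m∸n≡0 j<m∸n))

unique⇒length≤ : ∀ {k n} {xs : Vec (Fin k) n} → Unique xs → n ≤ k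
unique⇒length≤ {k} {n} {xs} u with n ≤? k
... | yes n≤k = n≤k
... | no n≰k  =
  let i , j , i<j , same = pigeonhole (≰⇒> n≰k) (lookup xs)
  in contradiction (lookup-injective u i j same) (<⇒≢ᶠ i<j)

module Automaton (St : Setting) (S : Buchi St) where
  open Setting St
  open Buchi S
  open import Data.Vec.Membership.DecPropositional (Fin._≟_ {nQ}) using () renaming (_∈?_ to _∈ᵥ?_)

  IsRun : Word St → (ℕ → Fin nQ) → Set
  IsRun w r = ∀ i → δ (r i) (w i) (r (suc i)) ≡ true

  InfinitelyOftenAccepting : (ℕ → Fin nQ) → Set
  InfinitelyOftenAccepting r = ∀ N → ∃ λ k → N ≤ k × acc (r k) ≡ true

  AcceptsFrom : Fin nQ → Word St → Set
  AcceptsFrom q w = Σ (ℕ → Fin nQ) λ r → r 0 ≡ q × IsRun w r × InfinitelyOftenAccepting r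

  NonemptyFrom : Fin nQ → Set
  NonemptyFrom q = ∃ (AcceptsFrom q)

  data Run : Fin nQ → List (Letter St) → Fin nQ → Set where
    []  : ∀ {q} → Run q [] q
    _∷_ : ∀ {q σ q₁ x q'} → δ q σ q₁ ≡ true → Run q₁ x q' → Run q (σ ∷ x) q'

  run? : ∀ q x q' → Dec (Run q x q')
  run? q []      q' with q Fin.≟ q'
  ... | yes refl = yes []
  ... | no q≢q'  = no λ { [] → q≢q' refl }
  run? q (σ ∷ x) q' with any? (λ q₁ → (δ q σ q₁ ≟ true) ×-dec run? q₁ x q')
  ... | yes (_ , d , r) = yes (d ∷ r)
  ... | no ∄            = no λ { (d ∷ r) → ∄ (_ , d , r) }

  Reachable : Fin nQ → Fin nQ → Set
  Reachable q q' = ∃ λ x → Run q x q'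

  Reachable⁺ : Fin nQ → Fin nQ → Set
  Reachable⁺ q q' = ∃₂ λ σ x → Run q (σ ∷ x) q'

  ∷-accepts : ∀ {q σ q₁ w} → δ q σ q₁ ≡ true → AcceptsFrom q₁ w → AcceptsFrom q (σ ∷ω w)
  ∷-accepts {q} d (r , refl , run , inf) = q ∷ω r , refl , run′ , inf′
    where
    run′ : IsRun _ (q ∷ω r)
    run′ zero    = d
    run′ (suc i) = run i
    inf′ : InfinitelyOftenAccepting (q ∷ω r)
    inf′ N = let k , N≤k , acc-k = inf N in suc k , m≤n⇒m≤1+n N≤k , acc-k

  ++-accepts : ∀ {q x q' w} → Run q x q' → AcceptsFrom q' w → AcceptsFrom q (x ++ω w)
  ++-accepts []      acc-w = acc-w
  ++-accepts (d ∷ r) acc-w = ∷-accepts d (++-accepts r acc-w)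

  prefix-run : ∀ {w r} → IsRun w r → ∀ m → Run (r 0) (prefix St w m) (r m)
  prefix-run         run zero    = []
  prefix-run {w} {r} run (suc m) = run 0 ∷ prefix-run {w ∘ suc} {r ∘ suc} (run ∘ suc) m

  drop-isRun : ∀ {w r} → IsRun w r → ∀ m → IsRun (λ i → w (m + i)) (λ i → r (m + i))
  drop-isRun {w} {r} run m i =
    subst (λ j → δ (r (m + i)) (w (m + i)) (r j) ≡ true) (sym (+-suc m i)) (run (m + i))

  drop-infinitelyOften : ∀ {r} → InfinitelyOftenAccepting r → ∀ m →
                         InfinitelyOftenAccepting (λ i → r (m + i))
  drop-infinitelyOften {r} inf m N =
    let k , m+N≤k , acc-k = inf (m + N)
    in k ∸ m , m+n≤o⇒m≤o∸n N (≤-trans (≤-reflexive (+-comm N m)) m+N≤k) ,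
       subst (λ i → acc (r i) ≡ true) (sym (m+[n∸m]≡n (m+n≤o⇒m≤o m m+N≤k))) acc-k

  drop-accepts : ∀ {w r} → IsRun w r → InfinitelyOftenAccepting r →
                 ∀ m → AcceptsFrom (r m) (λ i → w (m + i))
  drop-accepts {r = r} run inf m =
    r ∘ (m +_) , cong r (+-identityʳ m) , drop-isRun run m , drop-infinitelyOften inf m

  segment-run : ∀ {w r} → IsRun w r →
                ∀ a m → Run (r a) (prefix St (λ i → w (a + i)) m) (r (a + m))
  segment-run {r = r} run a m =
    subst (λ q → Run q _ (r (a + m))) (cong r (+-identityʳ a)) (prefix-run (drop-isRun run a) m)

  -- letter r and state r: the run that completes r, then repeats the lap p → q₁ → p forever.
  module Loop {p σ q₁ y} (d : δ p σ q₁ ≡ true) (rest : Run q₁ y p) where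

    letter : ∀ {q ys} → Run q ys p → Word St
    letter []                  zero    = σ
    letter []                  (suc i) = letter rest i
    letter (_∷_ {σ = τ} _ _)   zero    = τ
    letter (_ ∷ r)             (suc i) = letter r i

    state : ∀ {q ys} → Run q ys p → ℕ → Fin nQ
    state {q} _       zero    = q
    state     []      (suc i) = state rest i
    state     (_ ∷ r) (suc i) = state r i

    state-isRun : ∀ {q ys} (r : Run q ys p) → IsRun (letter r) (state r)
    state-isRun []      zero    = d
    state-isRun []      (suc i) = state-isRun rest i
    state-isRun (e ∷ r) zero    = e
    state-isRun (e ∷ r) (suc i) = state-isRun r i

    state-restarts : ∀ {q ys} (r : Run q ys p) i → state r (length ys + i) ≡ state [] i
    state-restarts []      i = refl
    state-restarts (_ ∷ r) i = state-restarts r i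

    state-periodic : ∀ k → state [] (k * suc (length y)) ≡ p
    state-periodic zero    = refl
    state-periodic (suc k) = trans (state-restarts rest (k * suc (length y))) (state-periodic k)

    accepts : acc p ≡ true → AcceptsFrom p (letter [])
    accepts acc-p = state [] , refl , state-isRun [] , λ N →
      N * suc (length y) , m≤m*n N (suc (length y)) ,
      subst (λ q → acc q ≡ true) (sym (state-periodic N)) acc-p

  repeated-accepting : ∀ {r} → InfinitelyOftenAccepting r →
                       ∃₂ λ a o → acc (r a) ≡ true × r a ≡ r (a + suc o)
  repeated-accepting {r} inf =
    let i , j , i<j , same = pigeonhole (n<1+n nQ) (r ∘ t ∘ toℕ)
        o , ti+1+o≡tj      = m≤n⇒∃[o]m+o≡n (t-mono i<j)
    in t (toℕ i) , o , t-acc (toℕ i) ,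
       trans same (cong r (trans (sym ti+1+o≡tj) (sym (+-suc (t (toℕ i)) o))))
    where
    t : ℕ → ℕ
    t zero    = proj₁ (inf 0)
    t (suc k) = proj₁ (inf (suc (t k)))
    t-acc : ∀ k → acc (r (t k)) ≡ true
    t-acc zero    = proj₂ (proj₂ (inf 0))
    t-acc (suc k) = proj₂ (proj₂ (inf (suc (t k))))
    t-step : ∀ k → t k < t (suc k)
    t-step k = proj₁ (proj₂ (inf (suc (t k))))
    t-mono : ∀ {i j} → i < j → t i < t j
    t-mono {i} {suc j} (s≤s i≤j) with m≤n⇒m<n∨m≡n i≤j
    ... | inj₁ i<j  = <-trans (t-mono i<j) (t-step j)
    ... | inj₂ refl = t-step i

  Lasso : Fin nQ → Set
  Lasso q = ∃ λ p → acc p ≡ true × Reachable q p × Reachable⁺ p p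

  lasso⇒nonempty : ∀ {q} → Lasso q → NonemptyFrom q
  lasso⇒nonempty (p , acc-p , (_ , stem) , (_ , _ , d ∷ rest)) =
    _ , ++-accepts stem (Loop.accepts d rest acc-p)

  nonempty⇒lasso : ∀ {q} → NonemptyFrom q → Lasso q
  nonempty⇒lasso (w , r , refl , run , inf) =
    let a , o , acc-a , ra≡ra+1+o = repeated-accepting inf
    in r a , acc-a , (_ , prefix-run run a) ,
       (_ , _ , subst (Run (r a) _) (sym ra≡ra+1+o) (segment-run run a (suc o)))

  states : ∀ {q x q'} → Run q x q' → Vec (Fin nQ) (suc (length x))
  states {q} []      = q ∷ []
  states {q} (_ ∷ r) = q ∷ states r

  SimpleRun : Fin nQ → Fin nQ → Set
  SimpleRun q q' = ∃ λ x → Σ (Run q x q') (Unique ∘ states)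

  simpleRun-from : ∀ {q₀ x q q'} {r : Run q₀ x q'} →
                   q ∈ᵥ states r → Unique (states r) → SimpleRun q q'
  simpleRun-from {r = []}        (here refl) u       = _ , [] , u
  simpleRun-from {r = r@(_ ∷ _)} (here refl) u       = _ , r , u
  simpleRun-from {r = _ ∷ _}     (there q∈)  (_ ∷ u) = simpleRun-from q∈ u

  -- cut out every cycle through the current state
  simplify : ∀ {q x q'} → Run q x q' → SimpleRun q q'
  simplify     []      = _ , [] , [] ∷ []
  simplify {q} (d ∷ r) with simplify r
  ... | _ , r′ , u with q ∈ᵥ? states r′
  ...   | yes q∈ = simpleRun-from q∈ u
  ...   | no q∉  = _ , d ∷ r′ , ∉⇒All≢ q∉ ∷ u

  reachable⇒short : ∀ {q q'} → Reachable q q' → ∃ λ x → length x < nQ × Run q x q'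
  reachable⇒short (_ , r) = let x , r′ , u = simplify r in x , unique⇒length≤ u , r′

  reachable? : ∀ q q' → Dec (Reachable q q')
  reachable? q q' =
    map′ (λ (_ , x , _ , r) → x , r) short
         (any? λ (m : Fin nQ) → ∃-ofLength? anySubset? (λ x → run? q x q') (toℕ m))
    where
    short : Reachable q q' → ∃ λ (m : Fin nQ) → ∃ λ x → length x ≡ toℕ m × Run q x q'
    short R = let x , lt , r = reachable⇒short R in fromℕ< lt , x , sym (toℕ-fromℕ< lt) , r

  reachable⁺? : ∀ q q' → Dec (Reachable⁺ q q')
  reachable⁺? q q' =
    map′ (λ (σ , _ , d , x , r) → σ , x , d ∷ r) (λ { (σ , x , d ∷ r) → σ , _ , d , x , r })
         (anySubset? λ σ → any? λ q₁ → (δ q σ q₁ ≟ true) ×-dec reachable? q₁ q')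

  nonempty? : ∀ q → Dec (NonemptyFrom q)
  nonempty? q = map′ lasso⇒nonempty nonempty⇒lasso
    (any? λ p → (acc p ≟ true) ×-dec reachable? q p ×-dec reachable⁺? p p)

  prefix-Pref⁺ : ∀ {w} → Accepts St S w → ∀ k → Pref⁺ St S (prefix St w (suc k))
  prefix-Pref⁺ {w} w∈L k = s≤s z≤n , w , w∈L , cong (applyUpTo w) (length-applyUpTo w (suc k))

  Pref⁺? : ∀ x → Dec (Pref⁺ St S x)
  Pref⁺? x = map′ fromRun toRun ((1 ≤? length x) ×-dec any? λ q → run? init x q ×-dec nonempty? q)
    where
    fromRun : (1 ≤ length x × ∃ λ q → Run init x q × NonemptyFrom q) → Pref⁺ St S x
    fromRun (1≤∣x∣ , _ , r , w , acc-w) = 1≤∣x∣ , x ++ω w , ++-accepts r acc-w , applyUpTo-++ω x w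
    toRun : Pref⁺ St S x → 1 ≤ length x × ∃ λ q → Run init x q × NonemptyFrom q
    toRun (1≤∣x∣ , w , (r , refl , run , inf) , w≤∣x∣≡x) =
      1≤∣x∣ , r (length x) , subst (λ y → Run _ y _) w≤∣x∣≡x (prefix-run run (length x)) ,
      _ , drop-accepts run inf (length x)

module Diagnosis (St : Setting) (S : Buchi St)
                 (a : Fin (Setting.nAg St)) (e : Fin (Setting.n St)) (D : ℕ) where
  open Automaton St S using (Pref⁺?; prefix-Pref⁺)

  observe : List (Letter St) → List (ObsLetter St a)
  observe = map (obs St a)

  DelayedFaultyExplanation : List (ObsLetter St a) → List (Letter St) → Set
  DelayedFaultyExplanation o x = observe x ≡ o × Faulty St e (take (length o ∸ D) x) × Pref⁺ St S x

  delayedFaultyExplanation? : ∀ o →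
    Dec (∃ λ x → length x ≡ length o × DelayedFaultyExplanation o x)
  delayedFaultyExplanation? o = ∃-ofLength? anySubset? explains? (length o)
    where
    explains? : ∀ x → Dec (DelayedFaultyExplanation o x)
    explains? x = List.≡-dec (Vec.≡-dec _≟_) (observe x) o
                  ×-dec Any.any? (e ∈ₛ?_) (take (length o ∸ D) x) ×-dec Pref⁺? x

  diagnoser : List (ObsLetter St a) → Bool
  diagnoser o = does (delayedFaultyExplanation? o)

  detects : ∀ (u v : List (Letter St)) → u ≢ [] → Faulty St e u → length v ≡ D →
            Pref⁺ St S (u ++ v) → diagnoser (observe (u ++ v)) ≡ true
  detects u v _ u-faulty ∣v∣≡D uv∈Pref with delayedFaultyExplanation? (observe (u ++ v))
  ... | yes _ = refl
  ... | no ∄  = ⊥-elim (∄ (u ++ v , sym (length-map _ (u ++ v)) , refl , faulty , uv∈Pref))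
    where
    ∣uv∣∸D≡∣u∣ : length (observe (u ++ v)) ∸ D ≡ length u
    ∣uv∣∸D≡∣u∣ = begin
      length (observe (u ++ v)) ∸ D ≡⟨ cong (_∸ D) (length-map _ (u ++ v)) ⟩
      length (u ++ v) ∸ D           ≡⟨ cong (_∸ D) (length-++ u) ⟩
      length u + length v ∸ D       ≡⟨ cong (λ k → length u + k ∸ D) ∣v∣≡D ⟩
      length u + D ∸ D              ≡⟨ m+n∸n≡m (length u) D ⟩
      length u                      ∎
      where open ≡-Reasoning
    faulty : Faulty St e (take (length (observe (u ++ v)) ∸ D) (u ++ v))
    faulty = subst (λ k → Faulty St e (take k (u ++ v))) (sym ∣uv∣∸D≡∣u∣)
                   (subst (Faulty St e) (sym (take-length-++ u v)) u-faulty)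

  observe-prefix : ∀ w {y s} → prefix St w (length y) ≡ y → s ≤ length y →
                   observe (prefix St w s) ≡ take s (observe y)
  observe-prefix w {y} {s} w≤∣y∣≡y s≤∣y∣ = begin
    observe (prefix St w s)                   ≡⟨ cong observe (take-applyUpTo w s≤∣y∣) ⟨
    observe (take s (prefix St w (length y))) ≡⟨ take-map s _ ⟨
    take s (observe (prefix St w (length y))) ≡⟨ cong (take s ∘ observe) w≤∣y∣≡y ⟩
    take s (observe y)                        ∎
    where open ≡-Reasoning

  fault-position : ∀ w {x k} → prefix St w (length x) ≡ x → k ≤ length x →
                   Faulty St e (take k x) → ∃ λ j → j < k × e ∈ w j
  fault-position w {x} {k} w≤∣x∣≡x k≤∣x∣ =
    applyUpTo⁻ w ∘ subst (Faulty St e)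
                         (trans (cong (take k) (sym w≤∣x∣≡x)) (take-applyUpTo w k≤∣x∣))

  -- D steps after the fault in w′, a knows in w′ that a fault occurred, and w looks the same to a.
  explained⇒faulty : Models St S (diagFormula St a e D) → ∀ {u x} → Pref⁺ St S u →
                     length x ≡ length (observe u) → DelayedFaultyExplanation (observe u) x →
                     Faulty St e u
  explained⇒faulty ⊨φ {u} {x} (_ , w , w∈L , w≤∣u∣≡u) ∣x∣≡∣o∣
                   (obs-x≡ , x-faulty , _ , w′ , w′∈L , w′≤∣x∣≡x)
    with fault-position w′ w′≤∣x∣≡x (≤-trans (m∸n≤m _ D) (≤-reflexive (sym ∣x∣≡∣o∣))) x-faulty
  ... | j , j<∣o∣∸D , e∈w′j =
    let s≤∣u∣                = subst (suc (j + D) ≤_) (length-map _ u) (<∸⇒+< j<∣o∣∸D)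
        j′ , j′≤j+D , e∈wj′ = ⊨φ w′ w′∈L j z≤n e∈w′j w w∈L (same-obs s≤∣u∣)
    in subst (Faulty St e) w≤∣u∣≡u (applyUpTo⁺ w e∈wj′ (≤-trans (s≤s j′≤j+D) s≤∣u∣))
    where
    same-obs : ∀ {s} → s ≤ length u → observe (prefix St w′ s) ≡ observe (prefix St w s)
    same-obs {s} s≤∣u∣ = begin
      observe (prefix St w′ s) ≡⟨ observe-prefix w′ w′≤∣x∣≡x s≤∣x∣ ⟩
      take s (observe x)       ≡⟨ cong (take s) obs-x≡ ⟩
      take s (observe u)       ≡⟨ observe-prefix w w≤∣u∣≡u s≤∣u∣ ⟨
      observe (prefix St w s)  ∎
      where
      open ≡-Reasoning
      s≤∣x∣ : s ≤ length x
      s≤∣x∣ = subst (s ≤_) (sym (trans ∣x∣≡∣o∣ (length-map _ u))) s≤∣u∣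

  no-false-alarms : Models St S (diagFormula St a e D) → ∀ u → Pref⁺ St S u → ¬ Faulty St e u →
                    diagnoser (observe u) ≡ false
  no-false-alarms ⊨φ u u∈Pref u-ok with delayedFaultyExplanation? (observe u)
  ... | yes (_ , ∣x∣≡∣o∣ , explains) =
    contradiction (explained⇒faulty ⊨φ u∈Pref ∣x∣≡∣o∣ explains) u-ok
  ... | no _ = refl

  diagnoser⇒⊨ : Σ (List (ObsLetter St a) → Bool) (IsDiagnoser St S a e D) →
                Models St S (diagFormula St a e D)
  diagnoser⇒⊨ (f , detect , no-alarm) w w∈L j _ e∈wj w′ w′∈L same-obs
    with Any.any? (e ∈ₛ?_) (prefix St w′ (suc (j + D)))
  ... | yes w′-faulty =
    let j′ , j′<s , e∈w′j′ = applyUpTo⁻ w′ w′-faulty in j′ , ≤-pred j′<s , e∈w′j′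
  ... | no w′-ok      = contradiction (trans (sym alarm) (trans (cong f same-obs) no-alarm′)) λ ()
    where
    stem delay : List (Letter St)
    stem  = prefix St w (suc j)
    delay = prefix St (λ i → w (suc j + i)) D
    w≤s≡stem++delay : prefix St w (suc (j + D)) ≡ stem ++ delay
    w≤s≡stem++delay = applyUpTo-+ w (suc j) D
    alarm : f (observe (prefix St w (suc (j + D)))) ≡ true
    alarm = subst (λ z → f (observe z) ≡ true) (sym w≤s≡stem++delay)
      (detect stem delay (λ ()) (applyUpTo⁺ w e∈wj ≤-refl) (length-applyUpTo _ D)
              (subst (Pref⁺ St S) w≤s≡stem++delay (prefix-Pref⁺ w∈L (j + D))))
    no-alarm′ : f (observe (prefix St w′ (suc (j + D)))) ≡ false
    no-alarm′ = no-alarm _ (prefix-Pref⁺ w′∈L (j + D)) w′-ok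

proposition3p10 : (St : Setting) (S : Buchi St) (a : Fin (Setting.nAg St)) (e : Fin (Setting.n St))
    → (∀ j → Setting.ι St a j ≢ e) → (D : ℕ)
    → Models St S (diagFormula St a e D)
      ⇔ Σ (List (ObsLetter St a) → Bool) (IsDiagnoser St S a e D)
proposition3p10 St S a e _ D = mk⇔ (λ ⊨φ → diagnoser , detects , no-false-alarms ⊨φ) diagnoser⇒⊨
  where open Diagnosis St S a e D
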